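{- For all $r\geq 3$, $$\sum_{N>0}\dim_{\mathbb Q}\ker\big(E^{(2)}_{N,r}\cdots E^{(r-1)}_{N,r}\big)\cdot x^N=\mathbb O(x)\sum_{N>0}\dim_{\mathbb Q}\ker C_{N,r-1}\cdot x^N.$$
   Context: $S_{N,r}=\{(n_1,\dots,n_r)\in\mathbb Z^r: n_1+\dots+n_r=N,\ n_i\geq 3\text{ odd}\}$. For $f$ a polynomial in one variable and $g$ in $r-1$ variables, $(f\circ g)(x_1,\dots,x_r)=f(x_1)g(x_2,\dots,x_r)+\sum_{i=1}^{r-1}\big(f(x_{i+1}-x_i)g(x_1,\dots,\widehat{x_{i+1}},\dots,x_r)-(-1)^{\deg f}f(x_i-x_{i+1})g(x_1,\dots,\widehat{x_i},\dots,x_r)\big)$. $e\binom{m_1,\dots,m_r}{n_1,\dots,n_r}$ is the coefficient of $x_1^{n_1-1}\cdots x_r^{n_r-1}$ in $x_1^{m_1-1}\circ(x_1^{m_2-1}\cdots x_{r-1}^{m_r-1})$. $E_{N,r}$ is the $S_{N,r}\times S_{N,r}$ matrix with $(m,n)$ entry $e\binom{m_1,\dots,m_r}{n_1,\dots,n_r}$; for $2\le j\le r$, $E^{(j)}_{N,r}$ has $(m,n)$ entry $\delta_{(m_1,\dots,m_{r-j}),(n_1,\dots,n_{r-j})}\,e\binom{m_{r-j+1},\dots,m_r}{n_{r-j+1},\dots,n_r}$ (Kronecker delta). $C_{N,r}=E^{(2)}_{N,r}\cdots E^{(r-1)}_{N,r}E_{N,r}$, with $C_{N,2}=E_{N,2}$.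 $\ker A$ is the space of right annihilators of $A$, dimensions taken over $\mathbb Q$. $\mathbb O(x)=\frac{x^3}{1-x^2}=x^3+x^5+\cdots$. -}

module Defs where

open import Data.Bool using (Bool; true; false; if_then_else_; _∧_; not)
open import Data.Nat as ℕ using (ℕ; zero; suc; _∸_; _<_; _≤_)
open import Data.Nat.Properties using () renaming (_≟_ to _≟ℕ_)
open import Data.Integer as ℤ using (ℤ; +_; -_)
open import Data.Rational as ℚ using (ℚ; 0ℚ; 1ℚ)
open import Data.List using (List; []; _∷_; map; concatMap; foldr; upTo; allFin;
  filterᵇ; take; drop; length; zipWith; replicate; _++_; concat)
open import Data.List.Properties using (≡-dec)
open import Data.List.Membership.Propositional using (_∈_)
open import Data.Fin using (Fin)
open import Data.Product using (_×_; _,_; ∃)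
open import Relation.Nullary using (¬_)
open import Relation.Nullary.Decidable using (⌊_⌋)
open import Relation.Binary.PropositionalEquality using (_≡_)

-- Polynomials with integer coefficients, as finite lists of terms
-- (coefficient, exponent list).  Variables are indexed 0,1,2,...
-- (x_1 of the paper is variable 0).

Mono : Set
Mono = List ℕ

Poly : Set
Poly = List (ℤ × Mono)

_==ᴸ_ : List ℕ → List ℕ → Bool
a ==ᴸ b = ⌊ ≡-dec _≟ℕ_ a b ⌋

boolToℕ : Bool → ℕ
boolToℕ true = 1
boolToℕ false = 0

unitM : ℕ → ℕ → Mono
unitM r a = map (λ i → boolToℕ ⌊ i ≟ℕ a ⌋) (upTo r)

oneP : ℕ → Poly
oneP r = (+ 1 , replicate r 0) ∷ []

scaleP : ℤ → Poly → Poly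
scaleP c = map (λ { (a , e) → (c ℤ.* a , e) })

mulP : Poly → Poly → Poly
mulP p q = concatMap (λ { (a , e) → map (λ { (b , e′) → (a ℤ.* b , zipWith ℕ._+_ e e′) }) q }) p

powP : ℕ → Poly → ℕ → Poly
powP r p zero = oneP r
powP r p (suc d) = mulP p (powP r p d)

varP : ℕ → ℕ → Poly
varP r a = (+ 1 , unitM r a) ∷ []

diffP : ℕ → ℕ → ℕ → Poly
diffP r a b = (+ 1 , unitM r a) ∷ (- (+ 1) , unitM r b) ∷ []

-- g(x_1,...,\hat{x_{i+1}},...,x_r): insert a zero exponent at (0-based) position i
insert0 : ℕ → Mono → Mono
insert0 i e = take i e ++ (0 ∷ drop i e)

skipP : ℕ → Poly → Poly
skipP i = map (λ { (c , e) → (c , insert0 i e) })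

coeff : Poly → Mono → ℤ
coeff p e = foldr (λ { (c , e′) acc → if e′ ==ᴸ e then c ℤ.+ acc else acc }) (+ 0) p

monoP : Mono → Poly
monoP e = (+ 1 , e) ∷ []

signPow : ℕ → ℤ
signPow zero = + 1
signPow (suc d) = - signPow d

-- f ∘ g for f = x^d (so deg f = d), g a polynomial in r-1 variables; result in r variables.
-- Indices are 0-based: the paper's i ∈ {1..r-1} is i'+1 with i' ∈ {0..r-2}.
circ : ℕ → ℕ → Poly → Poly
circ d r g =
  mulP (powP r (varP r 0) d) (skipP 0 g)
  ++ concat (map (λ i →
       mulP (powP r (diffP r (suc i) i) d) (skipP (suc i) g)
       ++ scaleP (- signPow d) (mulP (powP r (diffP r i (suc i)) d) (skipP i g)))
     (upTo (r ∸ 1)))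

-- e( m_1..m_r ; n_1..n_r ): coefficient of x^{n-1} in x_1^{m_1-1} ∘ (x_1^{m_2-1}⋯x_{r-1}^{m_r-1})
eCoef : List ℕ → List ℕ → ℤ
eCoef [] ns = + 0
eCoef (m₁ ∷ ms) ns =
  coeff (circ (m₁ ∸ 1) (suc (length ms)) (monoP (map (_∸ 1) ms))) (map (_∸ 1) ns)

-- The index set S_{N,r}, as the list of all r-tuples with entries in
-- {0..N} satisfying the defining conditions.

box : ℕ → ℕ → List (List ℕ)
box N zero = [] ∷ []
box N (suc r) = concatMap (λ a → map (a ∷_) (box N r)) (upTo (suc N))

oddᵇ : ℕ → Bool
oddᵇ zero = false
oddᵇ (suc n) = not (oddᵇ n)

sumL : List ℕ → ℕ
sumL = foldr ℕ._+_ 0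

allᵇ : (ℕ → Bool) → List ℕ → Bool
allᵇ p = foldr (λ a b → p a ∧ b) true

inSᵇ : ℕ → List ℕ → Bool
inSᵇ N n = ⌊ sumL n ≟ℕ N ⌋ ∧ allᵇ (λ a → oddᵇ a ∧ (3 ℕ.≤ᵇ a)) n

S : ℕ → ℕ → List (List ℕ)
S N r = filterᵇ (inSᵇ N) (box N r)

-- Matrices indexed by tuples, with rational entries (only entries with
-- both indices in S_{N,r} matter).

Mat : Set
Mat = List ℕ → List ℕ → ℚ

Vect : Set
Vect = List ℕ → ℚ

sumℚ : List ℚ → ℚ
sumℚ = foldr ℚ._+_ 0ℚ

mulM : List (List ℕ) → Mat → Mat → Mat
mulM I A B m n = sumℚ (map (λ k → A m k ℚ.* B k n) I)

idM : Mat
idM m n = if m ==ᴸ n then 1ℚ else 0ℚ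

Ej : ℕ → ℕ → Mat
Ej r j m n =
  if take (r ∸ j) m ==ᴸ take (r ∸ j) n
  then (eCoef (drop (r ∸ j) m) (drop (r ∸ j) n) ℚ./ 1) else 0ℚ

E : ℕ → Mat
E r = Ej r r

midRange : ℕ → List ℕ
midRange r = map (λ i → 2 ℕ.+ i) (upTo (r ∸ 2))

prodE : ℕ → ℕ → Mat
prodE N r = foldr (λ j P → mulM (S N r) (Ej r j) P) idM (midRange r)

C : ℕ → ℕ → Mat
C N r = mulM (S N r) (prodE N r) (E r)

InKer : List (List ℕ) → Mat → Vect → Set
InKer I A v = ∀ m → m ∈ I → sumℚ (map (λ n → A m n ℚ.* v n) I) ≡ 0ℚ

LinIndep : List (List ℕ) → {k : ℕ} → (Fin k → Vect) → Set
LinIndep I {k} vs = (c : Fin k → ℚ) →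
  (∀ n → n ∈ I → sumℚ (map (λ i → c i ℚ.* vs i n) (allFin k)) ≡ 0ℚ) →
  ∀ i → c i ≡ 0ℚ

DimKer : List (List ℕ) → Mat → ℕ → Set
DimKer I A d =
  (∃ λ (vs : Fin d → Vect) → (∀ i → InKer I A (vs i)) × LinIndep I vs)
  × (∀ (vs : Fin (suc d) → Vect) → (∀ i → InKer I A (vs i)) → ¬ LinIndep I vs)

-- coefficient of x^N in 𝕆(x) · Σ_{M>0} a_M x^M  =  Σ_{k odd, 3 ≤ k < N} a_{N-k}
OConvCoeff : (ℕ → ℕ) → ℕ → ℕ
OConvCoeff a N = sumL (map (λ k → a (N ∸ k))
  (filterᵇ (λ k → oddᵇ k ∧ (3 ℕ.≤ᵇ k)) (upTo N)))

-- A factor E^{(j)}_{N,r} with j ≤ r - 1 does not touch the first entry n₁ of an index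
-- tuple, so it is block diagonal with respect to n₁; the block at n₁ = a is E^{(j)}_{N-a,r-1}
-- on S_{N-a,r-1}.  Hence the product is block diagonal with blocks
-- E^{(2)}_{N-a,r-1} ⋯ E^{(r-1)}_{N-a,r-1} = C_{N-a,r-1}, its kernel is the direct sum of the
-- kernels of the blocks, and dimensions add.  The admissible first entries a are the odd
-- a ≥ 3 with a < N, which produces the factor 𝕆(x).

module Submission where

open import Defs
open import Data.Nat using (ℕ; zero; suc; _≤_; _<_; _∸_; z≤n; s≤s; _≤ᵇ_; _<?_)
  renaming (_+_ to _+ℕ_)
import Data.Nat.Properties as ℕP
open import Data.Rational as ℚ using (ℚ; 0ℚ; 1ℚ; _+_; _*_; -_; 1/_)
import Data.Rational.Properties as ℚP
open import Data.Rational.Solver using (module +-*-Solver)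
open import Data.Bool using (Bool; T; _∧_; if_then_else_)
import Data.Bool.Properties as BoolP
open import Data.Fin using (Fin; zero; suc; _↑ˡ_; _↑ʳ_; splitAt; join)
open import Data.Fin.Properties using (join-splitAt)
open import Data.Vec.Functional using () renaming (_∷_ to _◂_; _++_ to _⧺_)
open import Data.Vec.Functional.Properties using (lookup-++ˡ; lookup-++ʳ)
open import Data.List using (List; []; _∷_; _++_; map; concatMap; foldr; upTo; filterᵇ;
  length; take; drop; tabulate; allFin)
import Data.List.Properties as ListP
open import Data.List.Membership.Propositional using (_∈_)
open import Data.List.Membership.Propositional.Properties using (∈-++⁻; ∈-++⁺ˡ; ∈-++⁺ʳ;
  ∈-map⁻; ∈-map⁺; ∈-upTo⁺; ∈-upTo⁻; ∈-filter⁺; ∈-filter⁻)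
open import Data.List.Relation.Unary.Any using (here; there)
open import Data.List.Relation.Unary.All as All using (All; []; _∷_)
open import Data.List.Relation.Unary.Unique.Propositional using (Unique; []; _∷_)
import Data.List.Relation.Unary.Unique.Propositional.Properties as UniqueP
open import Data.List.Relation.Binary.Permutation.Propositional using (_↭_; ↭-sym; ↭⇒↭ₛ)
import Data.List.Relation.Binary.Permutation.Propositional.Properties as ↭P
import Data.List.Relation.Binary.Permutation.Setoid.Properties as ↭ₛP
open import Data.List.Relation.Binary.BagAndSetEquality using (∼bag⇒↭)
open import Data.List.Membership.Propositional.Properties.WithK using (unique∧set⇒bag)
open import Data.Product using (_×_; _,_; ∃; proj₁; proj₂)
open import Data.Sum using (_⊎_; inj₁; inj₂; [_,_]′)
open import Data.Empty using (⊥-elim)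
open import Data.Unit using (⊤; tt)
open import Function.Base using (_∘_; case_of_)
open import Function.Bundles using (Equivalence; _⇔_; mk⇔)
open import Function.Construct.Symmetry using (⇔-sym)
open import Relation.Nullary using (¬_; yes; no)
open import Relation.Nullary.Decidable using (⌊_⌋; toWitness; fromWitness; T?)
open import Relation.Binary.Definitions using (DecidableEquality)
open import Relation.Binary.PropositionalEquality
  using (_≡_; _≢_; refl; sym; trans; cong; cong₂; subst; setoid; module ≡-Reasoning)

open +-*-Solver using (solve; _:+_; _:*_; :-_; con; _:=_)
open ≡-Reasoning

cancel-nonzero : (p q : ℚ) → p * q ≡ 0ℚ → q ≢ 0ℚ → p ≡ 0ℚ
cancel-nonzero p q pq≡0 q≢0 = begin
  p              ≡⟨ sym (ℚP.*-identityʳ p) ⟩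
  p * 1ℚ         ≡⟨ cong (p *_) (sym (ℚP.*-inverseʳ q)) ⟩
  p * (q * 1/ q) ≡⟨ sym (ℚP.*-assoc p q (1/ q)) ⟩
  p * q * 1/ q   ≡⟨ cong (_* 1/ q) pq≡0 ⟩
  0ℚ * 1/ q      ≡⟨ ℚP.*-zeroˡ (1/ q) ⟩
  0ℚ             ∎
  where instance _ = ℚ.≢-nonZero q≢0

sumOver : {A : Set} → (A → ℚ) → List A → ℚ
sumOver f l = sumℚ (map f l)

sumOver-cong : {A : Set} (f g : A → ℚ) (l : List A) →
  (∀ x → x ∈ l → f x ≡ g x) → sumOver f l ≡ sumOver g l
sumOver-cong f g [] f≡g = refl
sumOver-cong f g (x ∷ l) f≡g =
  cong₂ _+_ (f≡g x (here refl)) (sumOver-cong f g l (λ y y∈l → f≡g y (there y∈l)))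

sumOver-zero : {A : Set} (f : A → ℚ) (l : List A) →
  (∀ x → x ∈ l → f x ≡ 0ℚ) → sumOver f l ≡ 0ℚ
sumOver-zero f l f≡0 = trans (sumOver-cong f (λ _ → 0ℚ) l f≡0) (sumZeros l)
  where
  sumZeros : {A : Set} (l : List A) → sumOver (λ _ → 0ℚ) l ≡ 0ℚ
  sumZeros []      = refl
  sumZeros (_ ∷ l) = trans (ℚP.+-identityˡ _) (sumZeros l)

sumOver-++ : {A : Set} (f : A → ℚ) (xs ys : List A) →
  sumOver f (xs ++ ys) ≡ sumOver f xs + sumOver f ys
sumOver-++ f []       ys = sym (ℚP.+-identityˡ _)
sumOver-++ f (x ∷ xs) ys =
  trans (cong (f x +_) (sumOver-++ f xs ys)) (sym (ℚP.+-assoc (f x) _ _))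

sumOver-blocks : {A : Set} (f : List A → ℚ) (F : A → List (List A)) (L : List A) →
  sumOver f (concatMap (λ a → map (a ∷_) (F a)) L) ≡ sumOver (λ a → sumOver (λ y → f (a ∷ y)) (F a)) L
sumOver-blocks f F []      = refl
sumOver-blocks f F (a ∷ L) = begin
  sumOver f (map (a ∷_) (F a) ++ rest)
    ≡⟨ sumOver-++ f (map (a ∷_) (F a)) rest ⟩
  sumOver f (map (a ∷_) (F a)) + sumOver f rest
    ≡⟨ cong₂ _+_ (cong sumℚ (sym (ListP.map-∘ (F a)))) (sumOver-blocks f F L) ⟩
  sumOver (λ y → f (a ∷ y)) (F a) + sumOver (λ b → sumOver (λ y → f (b ∷ y)) (F b)) L ∎
  where rest = concatMap (λ b → map (b ∷_) (F b)) L

sumOver-↭ : {A : Set} (f : A → ℚ) {xs ys : List A} → xs ↭ ys → sumOver f xs ≡ sumOver f ys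
sumOver-↭ f xs↭ys =
  ↭ₛP.foldr-commMonoid (setoid ℚ) ℚP.+-0-isCommutativeMonoid (↭⇒↭ₛ (↭P.map⁺ f xs↭ys))

sumOver-+ : {A : Set} (f g : A → ℚ) (l : List A) →
  sumOver (λ x → f x + g x) l ≡ sumOver f l + sumOver g l
sumOver-+ f g []      = sym (ℚP.+-identityˡ 0ℚ)
sumOver-+ f g (x ∷ l) rewrite sumOver-+ f g l =
  solve 4 (λ a b c d → (a :+ b) :+ (c :+ d) := (a :+ c) :+ (b :+ d)) refl
    (f x) (g x) (sumOver f l) (sumOver g l)

sumOver-*ˡ : {A : Set} (p : ℚ) (f : A → ℚ) (l : List A) →
  p * sumOver f l ≡ sumOver (λ x → p * f x) l
sumOver-*ˡ p f []      = ℚP.*-zeroʳ p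
sumOver-*ˡ p f (x ∷ l) =
  trans (ℚP.*-distribˡ-+ p (f x) (sumOver f l)) (cong (p * f x +_) (sumOver-*ˡ p f l))

sumOver-*ʳ : {A : Set} (p : ℚ) (f : A → ℚ) (l : List A) →
  sumOver f l * p ≡ sumOver (λ x → f x * p) l
sumOver-*ʳ p f []      = ℚP.*-zeroˡ p
sumOver-*ʳ p f (x ∷ l) =
  trans (ℚP.*-distribʳ-+ p (f x) (sumOver f l)) (cong (f x * p +_) (sumOver-*ʳ p f l))

sumOver-swap : {A B : Set} (h : A → B → ℚ) (l : List A) (l′ : List B) →
  sumOver (λ x → sumOver (h x) l′) l ≡ sumOver (λ y → sumOver (λ x → h x y) l) l′
sumOver-swap h []      l′ = sym (sumOver-zero _ l′ (λ _ _ → refl))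
sumOver-swap h (x ∷ l) l′ =
  trans (cong (sumOver (h x) l′ +_) (sumOver-swap h l l′))
        (sym (sumOver-+ (h x) (λ y → sumOver (λ x → h x y) l) l′))

module KroneckerDelta {A : Set} (_≟_ : DecidableEquality A) where

  δ : A → A → ℚ → ℚ
  δ a b q = if ⌊ a ≟ b ⌋ then q else 0ℚ

  δ-same : ∀ a q → δ a a q ≡ q
  δ-same a q with a ≟ a
  ... | yes _  = refl
  ... | no a≢a = ⊥-elim (a≢a refl)

  δ-diff : ∀ a b q → a ≢ b → δ a b q ≡ 0ℚ
  δ-diff a b q a≢b with a ≟ b
  ... | yes a≡b = ⊥-elim (a≢b a≡b)
  ... | no _    = refl

  δ-sym : ∀ a b q → δ a b q ≡ δ b a q
  δ-sym a b q with a ≟ b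
  ... | yes refl = sym (δ-same a q)
  ... | no a≢b   = sym (δ-diff b a q (λ b≡a → a≢b (sym b≡a)))

  δ-*ʳ : ∀ a b p q → δ a b p * q ≡ δ a b (p * q)
  δ-*ʳ a b p q with a ≟ b
  ... | yes _ = refl
  ... | no _  = ℚP.*-zeroˡ q

  δ-*ˡ : ∀ a b p q → q * δ a b p ≡ δ a b (q * p)
  δ-*ˡ a b p q with a ≟ b
  ... | yes _ = refl
  ... | no _  = ℚP.*-zeroʳ q

  δ-sumOver : {B : Set} → ∀ a b (f : B → ℚ) (l : List B) →
    sumOver (λ x → δ a b (f x)) l ≡ δ a b (sumOver f l)
  δ-sumOver a b f l with a ≟ b
  ... | yes _ = refl
  ... | no _  = sumOver-zero _ l (λ _ _ → refl)

  sumOver-δ : ∀ a (f : A → ℚ) (l : List A) → Unique l → a ∈ l →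
    sumOver (λ x → δ a x (f x)) l ≡ f a
  sumOver-δ a f (x ∷ l) (x∉l ∷ _) (here refl) = begin
    δ a a (f a) + sumOver (λ y → δ a y (f y)) l ≡⟨ cong₂ _+_ (δ-same a (f a)) rest≡0 ⟩
    f a + 0ℚ                                    ≡⟨ ℚP.+-identityʳ (f a) ⟩
    f a                                         ∎
    where
    rest≡0 : sumOver (λ y → δ a y (f y)) l ≡ 0ℚ
    rest≡0 = sumOver-zero _ l (λ y y∈l → δ-diff a y (f y) (All.lookup x∉l y∈l))
  sumOver-δ a f (x ∷ l) (x∉l ∷ l-unique) (there a∈l) = begin
    δ a x (f x) + sumOver (λ y → δ a y (f y)) l ≡⟨ cong₂ _+_ (δ-diff a x (f x) a≢x) (sumOver-δ a f l l-unique a∈l) ⟩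
    0ℚ + f a                                    ≡⟨ ℚP.+-identityˡ (f a) ⟩
    f a                                         ∎
    where
    a≢x : a ≢ x
    a≢x a≡x = All.lookup x∉l a∈l (sym a≡x)

module Δℕ = KroneckerDelta ℕP._≟_
module Δ = KroneckerDelta (ListP.≡-dec ℕP._≟_)

mulM-assoc : ∀ T (A B X : Mat) m n →
  mulM T A (mulM T B X) m n ≡ mulM T (mulM T A B) X m n
mulM-assoc T A B X m n = begin
  sumOver (λ k → A m k * sumOver (λ l → B k l * X l n) T) T
    ≡⟨ sumOver-cong _ _ T (λ k _ → sumOver-*ˡ (A m k) (λ l → B k l * X l n) T) ⟩
  sumOver (λ k → sumOver (λ l → A m k * (B k l * X l n)) T) T
    ≡⟨ sumOver-swap (λ k l → A m k * (B k l * X l n)) T T ⟩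
  sumOver (λ l → sumOver (λ k → A m k * (B k l * X l n)) T) T
    ≡⟨ sumOver-cong _ _ T (λ l _ → sumOver-cong _ _ T (λ k _ → sym (ℚP.*-assoc (A m k) (B k l) (X l n)))) ⟩
  sumOver (λ l → sumOver (λ k → A m k * B k l * X l n) T) T
    ≡⟨ sumOver-cong _ _ T (λ l _ → sym (sumOver-*ʳ (X l n) (λ k → A m k * B k l) T)) ⟩
  sumOver (λ l → sumOver (λ k → A m k * B k l) T * X l n) T ∎

mulM-congʳ : ∀ T (A B B′ : Mat) m n → (∀ k → k ∈ T → B k n ≡ B′ k n) →
  mulM T A B m n ≡ mulM T A B′ m n
mulM-congʳ T A B B′ m n B≡B′ = sumOver-cong _ _ T (λ k k∈T → cong (A m k *_) (B≡B′ k k∈T))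

mulM-idʳ : ∀ T (X : Mat) m n → Unique T → n ∈ T → mulM T X idM m n ≡ X m n
mulM-idʳ T X m n T-unique n∈T = begin
  sumOver (λ k → X m k * Δ.δ k n 1ℚ) T
    ≡⟨ sumOver-cong _ _ T (λ k _ → trans (Δ.δ-*ˡ k n 1ℚ (X m k)) (Δ.δ-sym k n (X m k * 1ℚ))) ⟩
  sumOver (λ k → Δ.δ n k (X m k * 1ℚ)) T
    ≡⟨ Δ.sumOver-δ n (λ k → X m k * 1ℚ) T T-unique n∈T ⟩
  X m n * 1ℚ
    ≡⟨ ℚP.*-identityʳ (X m n) ⟩
  X m n ∎

mulM-idˡ : ∀ T (X : Mat) m n → Unique T → m ∈ T → mulM T idM X m n ≡ X m n
mulM-idˡ T X m n T-unique m∈T = begin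
  sumOver (λ k → Δ.δ m k 1ℚ * X k n) T
    ≡⟨ sumOver-cong _ _ T (λ k _ → Δ.δ-*ʳ m k 1ℚ (X k n)) ⟩
  sumOver (λ k → Δ.δ m k (1ℚ * X k n)) T
    ≡⟨ Δ.sumOver-δ m (λ k → 1ℚ * X k n) T T-unique m∈T ⟩
  1ℚ * X m n
    ≡⟨ ℚP.*-identityˡ (X m n) ⟩
  X m n ∎

prodOver : List (List ℕ) → (ℕ → Mat) → List ℕ → Mat
prodOver T M = foldr (λ j P → mulM T (M j) P) idM

prodOver-snoc : ∀ T (M : ℕ → Mat) (X : Mat) (js : List ℕ) m n → Unique T → m ∈ T → n ∈ T →
  foldr (λ j P → mulM T (M j) P) (mulM T X idM) js m n ≡ mulM T (prodOver T M js) X m n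
prodOver-snoc T M X []       m n T-unique m∈T n∈T =
  trans (mulM-idʳ T X m n T-unique n∈T) (sym (mulM-idˡ T X m n T-unique m∈T))
prodOver-snoc T M X (j ∷ js) m n T-unique m∈T n∈T =
  trans (mulM-congʳ T (M j) (foldr (λ j P → mulM T (M j) P) (mulM T X idM) js) (mulM T (prodOver T M js) X) m n
          (λ k k∈T → prodOver-snoc T M X js k n T-unique k∈T n∈T))
        (mulM-assoc T (M j) (prodOver T M js) X m n)

-- Vectors are functions List ℕ → ℚ; only their values on a set of coordinates C
-- matter.  Independence and dimension are therefore taken relative to C.

lincomb : ∀ {k} → (Fin k → ℚ) → (Fin k → Vect) → Vect
lincomb {zero}  c vs n = 0ℚ
lincomb {suc k} c vs n = c zero * vs zero n + lincomb (λ i → c (suc i)) (λ i → vs (suc i)) n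

Independent : (List ℕ → Set) → ∀ {k} → (Fin k → Vect) → Set
Independent C {k} vs = (c : Fin k → ℚ) → (∀ n → C n → lincomb c vs n ≡ 0ℚ) → ∀ i → c i ≡ 0ℚ

DimAtMost : (List ℕ → Set) → (Vect → Set) → ℕ → Set
DimAtMost C P b = (vs : Fin (suc b) → Vect) → (∀ i → P (vs i)) → ¬ Independent C vs

HasDim : (List ℕ → Set) → (Vect → Set) → ℕ → Set
HasDim C P d = (∃ λ (vs : Fin d → Vect) → (∀ i → P (vs i)) × Independent C vs) × DimAtMost C P d

-- Closure under v ↦ v + β u: the only property of subspaces the elimination argument needs.
Subspace : (Vect → Set) → Set
Subspace P = ∀ v u β → P v → P u → P (λ n → v n + β * u n)

independent-mono : ∀ {C C′ : List ℕ → Set} {k} (vs : Fin k → Vect) →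
  (∀ n → C′ n → C n) → Independent C′ vs → Independent C vs
independent-mono vs C′⊆C indep c vanish = indep c (λ n n∈C′ → vanish n (C′⊆C n n∈C′))

lincomb-congᵛ : ∀ {k} (c : Fin k → ℚ) (vs vs′ : Fin k → Vect) n →
  (∀ i → vs i n ≡ vs′ i n) → lincomb c vs n ≡ lincomb c vs′ n
lincomb-congᵛ {zero}  c vs vs′ n eq = refl
lincomb-congᵛ {suc k} c vs vs′ n eq =
  cong₂ _+_ (cong (c zero *_) (eq zero)) (lincomb-congᵛ (λ i → c (suc i)) _ _ n (λ i → eq (suc i)))

lincomb-zeroᵛ : ∀ {k} (c : Fin k → ℚ) (vs : Fin k → Vect) n →
  (∀ i → vs i n ≡ 0ℚ) → lincomb c vs n ≡ 0ℚ
lincomb-zeroᵛ {zero}  c vs n vs≡0 = refl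
lincomb-zeroᵛ {suc k} c vs n vs≡0 = begin
  c zero * vs zero n + lincomb (λ i → c (suc i)) (λ i → vs (suc i)) n
    ≡⟨ cong₂ _+_ (cong (c zero *_) (vs≡0 zero)) (lincomb-zeroᵛ _ _ n (λ i → vs≡0 (suc i))) ⟩
  c zero * 0ℚ + 0ℚ
    ≡⟨ trans (ℚP.+-identityʳ _) (ℚP.*-zeroʳ (c zero)) ⟩
  0ℚ ∎

lincomb-zeroᶜ : ∀ {k} (c : Fin k → ℚ) (vs : Fin k → Vect) n →
  (∀ i → c i ≡ 0ℚ) → lincomb c vs n ≡ 0ℚ
lincomb-zeroᶜ {zero}  c vs n c≡0 = refl
lincomb-zeroᶜ {suc k} c vs n c≡0 = begin
  c zero * vs zero n + lincomb (λ i → c (suc i)) (λ i → vs (suc i)) n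
    ≡⟨ cong₂ _+_ (cong (_* vs zero n) (c≡0 zero)) (lincomb-zeroᶜ _ _ n (λ i → c≡0 (suc i))) ⟩
  0ℚ * vs zero n + 0ℚ
    ≡⟨ trans (ℚP.+-identityʳ _) (ℚP.*-zeroˡ (vs zero n)) ⟩
  0ℚ ∎

dot : ∀ {k} → (Fin k → ℚ) → (Fin k → ℚ) → ℚ
dot c β = lincomb c (λ i _ → β i) []

lincomb-shift : ∀ {k} (c β : Fin k → ℚ) (us : Fin k → Vect) (z : Vect) n →
  lincomb c (λ i m → us i m + β i * z m) n ≡ lincomb c us n + dot c β * z n
lincomb-shift {zero}  c β us z n = sym (trans (ℚP.+-identityˡ _) (ℚP.*-zeroˡ (z n)))
lincomb-shift {suc k} c β us z n
  rewrite lincomb-shift (λ i → c (suc i)) (λ i → β (suc i)) (λ i → us (suc i)) z n =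
  solve 6 (λ a b c d e f → a :* (b :+ c :* d) :+ (e :+ f :* d) := a :* b :+ e :+ (a :* c :+ f) :* d)
    refl (c zero) (us zero n) (β zero) (z n)
    (lincomb (λ i → c (suc i)) (λ i → us (suc i)) n) (dot (λ i → c (suc i)) (λ i → β (suc i)))

-- The definition of independence in Defs sums over allFin k instead of recursing on k.
lincomb-allFin : ∀ {k} (c : Fin k → ℚ) (vs : Fin k → Vect) n →
  sumℚ (map (λ i → c i * vs i n) (allFin k)) ≡ lincomb c vs n
lincomb-allFin {k} c vs n =
  trans (cong sumℚ (ListP.map-tabulate (λ i → i) (λ i → c i * vs i n))) (sumTabulate c vs)
  where
  sumTabulate : ∀ {k} (c : Fin k → ℚ) (vs : Fin k → Vect) →
    sumℚ (tabulate (λ i → c i * vs i n)) ≡ lincomb c vs n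
  sumTabulate {zero}  c vs = refl
  sumTabulate {suc k} c vs = cong (c zero * vs zero n +_) (sumTabulate (λ i → c (suc i)) (λ i → vs (suc i)))

linIndep⇒independent : ∀ I {k} (vs : Fin k → Vect) → LinIndep I vs → Independent (_∈ I) vs
linIndep⇒independent I vs indep c vanish = indep c (λ n n∈I → trans (lincomb-allFin c vs n) (vanish n n∈I))

independent⇒linIndep : ∀ I {k} (vs : Fin k → Vect) → Independent (_∈ I) vs → LinIndep I vs
independent⇒linIndep I vs indep c vanish = indep c (λ n n∈I → trans (sym (lincomb-allFin c vs n)) (vanish n n∈I))

_∪_ : List (List ℕ) → List (List ℕ) → List ℕ → Set
(I ∪ J) n = n ∈ I ⊎ n ∈ J

∪-comm : ∀ I J n → (I ∪ J) n → (J ∪ I) n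
∪-comm I J n (inj₁ n∈I) = inj₂ n∈I
∪-comm I J n (inj₂ n∈J) = inj₁ n∈J

vanishes-or-pivot : (I : List (List ℕ)) (v : Vect) →
  (∀ n → n ∈ I → v n ≡ 0ℚ) ⊎ ∃ λ n → n ∈ I × v n ≢ 0ℚ
vanishes-or-pivot []      v = inj₁ (λ n ())
vanishes-or-pivot (x ∷ I) v with v x ℚP.≟ 0ℚ | vanishes-or-pivot I v
... | no vx≢0 | _                          = inj₂ (x , here refl , vx≢0)
... | yes _   | inj₂ (n , n∈I , vn≢0)      = inj₂ (n , there n∈I , vn≢0)
... | yes vx≡0 | inj₁ v≡0                  = inj₁ λ { n (here refl) → vx≡0 ; n (there n∈I) → v≡0 n n∈I }

-- A family whose first vector vanishes on C is dependent on C (take the combination 1·w₀).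
head-vanishing⇒dependent : ∀ {C : List ℕ → Set} {k} (w : Fin (suc k) → Vect) →
  (∀ n → C n → w zero n ≡ 0ℚ) → ¬ Independent C w
head-vanishing⇒dependent {C} {k} w w₀≡0 indep = 1≢0 (indep e₀ e₀-vanishes zero)
  where
  1≢0 : 1ℚ ≢ 0ℚ
  1≢0 ()
  e₀ : Fin (suc k) → ℚ
  e₀ zero    = 1ℚ
  e₀ (suc i) = 0ℚ
  e₀-vanishes : ∀ n → C n → lincomb e₀ w n ≡ 0ℚ
  e₀-vanishes n n∈C = begin
    1ℚ * w zero n + lincomb (λ _ → 0ℚ) (λ i → w (suc i)) n
      ≡⟨ cong₂ (λ x y → 1ℚ * x + y) (w₀≡0 n n∈C) (lincomb-zeroᶜ (λ _ → 0ℚ) (λ i → w (suc i)) n (λ _ → refl)) ⟩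
    1ℚ * 0ℚ + 0ℚ
      ≡⟨⟩
    0ℚ ∎

-- Prepending a vector v to an independent family that vanishes at a pivot n₀ of v
-- keeps it independent: the coefficient of v is read off at n₀.
prepend-independent : ∀ {C : List ℕ → Set} {k} (v : Vect) (vs : Fin k → Vect) n₀ → C n₀ → v n₀ ≢ 0ℚ →
  (∀ i → vs i n₀ ≡ 0ℚ) → Independent C vs → Independent C (v ◂ vs)
prepend-independent {C} v vs n₀ n₀∈C vn₀≢0 vs≡0 indep c vanish = coefficients≡0
  where
  c₀≡0 : c zero ≡ 0ℚ
  c₀≡0 = cancel-nonzero (c zero) (v n₀) (begin
    c zero * v n₀                                    ≡⟨ sym (ℚP.+-identityʳ _) ⟩
    c zero * v n₀ + 0ℚ                               ≡⟨ cong (c zero * v n₀ +_) (sym (lincomb-zeroᵛ _ vs n₀ vs≡0)) ⟩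
    c zero * v n₀ + lincomb (λ i → c (suc i)) vs n₀  ≡⟨ vanish n₀ n₀∈C ⟩
    0ℚ                                               ∎) vn₀≢0
  rest-vanishes : ∀ n → C n → lincomb (λ i → c (suc i)) vs n ≡ 0ℚ
  rest-vanishes n n∈C = begin
    rest                 ≡⟨ sym (ℚP.+-identityˡ rest) ⟩
    0ℚ + rest            ≡⟨ cong (_+ rest) (sym (ℚP.*-zeroˡ (v n))) ⟩
    0ℚ * v n + rest      ≡⟨ cong (λ x → x * v n + rest) (sym c₀≡0) ⟩
    c zero * v n + rest  ≡⟨ vanish n n∈C ⟩
    0ℚ                   ∎
    where rest = lincomb (λ i → c (suc i)) vs n
  coefficients≡0 : ∀ i → c i ≡ 0ℚ
  coefficients≡0 zero    = c₀≡0
  coefficients≡0 (suc i) = indep (λ i → c (suc i)) rest-vanishes i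

shear : ∀ {k} → (Fin k → ℚ) → (Fin (suc k) → Vect) → Fin k → Vect
shear γ w i n = w (suc i) n + γ i * w zero n

shear-independent : ∀ {C : List ℕ → Set} {k} (γ : Fin k → ℚ) (w : Fin (suc k) → Vect) →
  Independent C w → Independent C (shear γ w)
shear-independent {C} γ w indep ν vanish i = indep (dot ν γ ◂ ν) w-vanishes (suc i)
  where
  w-vanishes : ∀ n → C n → lincomb (dot ν γ ◂ ν) w n ≡ 0ℚ
  w-vanishes n n∈C = begin
    dot ν γ * w zero n + lincomb ν (λ i → w (suc i)) n ≡⟨ ℚP.+-comm (dot ν γ * w zero n) _ ⟩
    lincomb ν (λ i → w (suc i)) n + dot ν γ * w zero n ≡⟨ sym (lincomb-shift ν γ (λ i → w (suc i)) (w zero) n) ⟩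
    lincomb ν (shear γ w) n                            ≡⟨ vanish n n∈C ⟩
    0ℚ                                                 ∎

vanishingAt : (Vect → Set) → List ℕ → Vect → Set
vanishingAt P n₀ v = P v × v n₀ ≡ 0ℚ

subspace-vanishingAt : ∀ {P} n₀ → Subspace P → Subspace (vanishingAt P n₀)
subspace-vanishingAt n₀ P-sub v u β (Pv , vn₀≡0) (Pu , un₀≡0) = P-sub v u β Pv Pu , (begin
  v n₀ + β * u n₀ ≡⟨ cong₂ (λ x y → x + β * y) vn₀≡0 un₀≡0 ⟩
  0ℚ + β * 0ℚ     ≡⟨ trans (ℚP.+-identityˡ _) (ℚP.*-zeroʳ β) ⟩
  0ℚ              ∎)

-- If w₀ ∈ P has a pivot n₀ ∈ C, cutting P down to v n₀ = 0 lowers its dimension bound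
-- by one: w₀ extends every independent family of the cut-down space.
dimAtMost-vanishingAt : ∀ {C P} c (w₀ : Vect) n₀ → C n₀ → w₀ n₀ ≢ 0ℚ → P w₀ →
  DimAtMost C P (suc c) → DimAtMost C (vanishingAt P n₀) c
dimAtMost-vanishingAt c w₀ n₀ n₀∈C w₀n₀≢0 Pw₀ P≤suc-c vs vs-in indep =
  P≤suc-c (w₀ ◂ vs) (λ { zero → Pw₀ ; (suc i) → proj₁ (vs-in i) })
    (prepend-independent w₀ vs n₀ n₀∈C w₀n₀≢0 (λ i → proj₂ (vs-in i)) indep)

pivotMultipliers : ∀ {k} (w : Fin (suc k) → Vect) n₀ → w zero n₀ ≢ 0ℚ → Fin k → ℚ
pivotMultipliers w n₀ w₀n₀≢0 i = - (w (suc i) n₀ * 1/ w zero n₀)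
  where instance _ = ℚ.≢-nonZero w₀n₀≢0

shear-clears-pivot : ∀ {k} (w : Fin (suc k) → Vect) n₀ (w₀n₀≢0 : w zero n₀ ≢ 0ℚ) i →
  shear (pivotMultipliers w n₀ w₀n₀≢0) w i n₀ ≡ 0ℚ
shear-clears-pivot w n₀ w₀n₀≢0 i = begin
  x + - (x * 1/ p) * p ≡⟨ solve 3 (λ x y p → x :+ (:- (x :* y)) :* p := x :+ (:- x) :* (y :* p)) refl x (1/ p) p ⟩
  x + - x * (1/ p * p) ≡⟨ cong (λ y → x + - x * y) (ℚP.*-inverseˡ p) ⟩
  x + - x * 1ℚ         ≡⟨ solve 1 (λ x → x :+ (:- x) :* con 1ℚ := con 0ℚ) refl x ⟩
  0ℚ                   ∎
  where
  x = w (suc i) n₀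
  p = w zero n₀
  instance _ = ℚ.≢-nonZero w₀n₀≢0

IntersectionBound : ℕ → Set₁
IntersectionBound K = ∀ c e (I J : List (List ℕ)) (P Q : Vect → Set) → Subspace P → Subspace Q →
  DimAtMost (_∈ I) P c → DimAtMost (_∈ J) Q e → c +ℕ e < K →
  (w : Fin K → Vect) → (∀ i → P (w i)) → (∀ i → Q (w i)) → ¬ Independent (I ∪ J) w

-- One elimination step.  Given a pivot n₀ ∈ I of w₀, clear it from the other vectors:
-- they remain independent, lie in P ∩ {v n₀ = 0} (dimension ≤ c - 1) and in Q.
pivot-step : ∀ K → IntersectionBound K →
  ∀ c e I J P Q → Subspace P → Subspace Q → DimAtMost (_∈ I) P c → DimAtMost (_∈ J) Q e →
  c +ℕ e < suc K → (w : Fin (suc K) → Vect) → (∀ i → P (w i)) → (∀ i → Q (w i)) →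
  ∀ n₀ → n₀ ∈ I → w zero n₀ ≢ 0ℚ → ¬ Independent (I ∪ J) w
pivot-step K bound zero e I J P Q P-sub Q-sub P≤0 Q≤e _ w w∈P w∈Q n₀ n₀∈I w₀n₀≢0 _ =
  P≤0 (w zero ◂ λ ()) (λ { zero → w∈P zero })
    (prepend-independent (w zero) (λ ()) n₀ n₀∈I w₀n₀≢0 (λ ()) (λ _ _ ()))
pivot-step K bound (suc c) e I J P Q P-sub Q-sub P≤suc-c Q≤e (s≤s c+e<K)
           w w∈P w∈Q n₀ n₀∈I w₀n₀≢0 indep =
  bound c e I J (vanishingAt P n₀) Q (subspace-vanishingAt n₀ P-sub) Q-sub
    (dimAtMost-vanishingAt {P = P} c (w zero) n₀ n₀∈I w₀n₀≢0 (w∈P zero) P≤suc-c) Q≤e c+e<K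
    w′ (λ i → inSubspace P-sub w∈P i , shear-clears-pivot w n₀ w₀n₀≢0 i) (inSubspace Q-sub w∈Q)
    (shear-independent γ w indep)
  where
  γ = pivotMultipliers w n₀ w₀n₀≢0
  w′ = shear γ w
  inSubspace : ∀ {R} → Subspace R → (∀ i → R (w i)) → ∀ i → R (w′ i)
  inSubspace R-sub w∈R i = R-sub (w (suc i)) (w zero) (γ i) (w∈R (suc i)) (w∈R zero)

-- The elimination argument, by induction on the number of vectors: w₀ either has a
-- pivot in I, one in J, or vanishes on I ∪ J (and then the family is dependent).
intersection-bound : ∀ K → IntersectionBound K
intersection-bound zero c e I J P Q P-sub Q-sub P≤c Q≤e ()
intersection-bound (suc K) c e I J P Q P-sub Q-sub P≤c Q≤e c+e<K w w∈P w∈Q indep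
  with vanishes-or-pivot I (w zero) | vanishes-or-pivot J (w zero)
... | inj₂ (n₀ , n₀∈I , w₀n₀≢0) | _ =
  pivot-step K (intersection-bound K) c e I J P Q P-sub Q-sub P≤c Q≤e c+e<K
    w w∈P w∈Q n₀ n₀∈I w₀n₀≢0 indep
... | inj₁ _ | inj₂ (n₀ , n₀∈J , w₀n₀≢0) =
  pivot-step K (intersection-bound K) e c J I Q P Q-sub P-sub Q≤e P≤c (subst (_< suc K) (ℕP.+-comm c e) c+e<K)
    w w∈Q w∈P n₀ n₀∈J w₀n₀≢0 (independent-mono w (∪-comm I J) indep)
... | inj₁ w₀≡0-on-I | inj₁ w₀≡0-on-J =
  head-vanishing⇒dependent w
    (λ { n (inj₁ n∈I) → w₀≡0-on-I n n∈I ; n (inj₂ n∈J) → w₀≡0-on-J n n∈J }) indep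

dimAtMost-[] : (P : Vect → Set) → DimAtMost (_∈ []) P 0
dimAtMost-[] P vs _ = head-vanishing⇒dependent vs (λ n ())

independent-size : ∀ {k b} I P → Subspace P → DimAtMost (_∈ I) P b →
  (vs : Fin k → Vect) → (∀ i → P (vs i)) → Independent (_∈ I) vs → k ≤ b
independent-size {k} {b} I P P-sub P≤b vs vs∈P indep with b <? k
... | no b≮k  = ℕP.≮⇒≥ b≮k
... | yes b<k = ⊥-elim (intersection-bound k b 0 I [] P (λ _ → ⊤) P-sub (λ _ _ _ _ _ → tt)
    P≤b (dimAtMost-[] _)
    (subst (_< k) (sym (ℕP.+-identityʳ b)) b<k) vs vs∈P (λ _ → tt)
    (independent-mono vs (λ n → inj₁) indep))

hasDim-unique : ∀ {d d′} I P → Subspace P → HasDim (_∈ I) P d → HasDim (_∈ I) P d′ → d ≡ d′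
hasDim-unique I P P-sub ((vs , vs∈P , vs-indep) , P≤d) ((vs′ , vs′∈P , vs′-indep) , P≤d′) =
  ℕP.≤-antisym (independent-size I P P-sub P≤d′ vs vs∈P vs-indep)
               (independent-size I P P-sub P≤d vs′ vs′∈P vs′-indep)

lincomb-∘ : ∀ {k} (c : Fin k → ℚ) (vs : Fin k → Vect) (f : List ℕ → List ℕ) m →
  lincomb c (λ i n → vs i (f n)) m ≡ lincomb c vs (f m)
lincomb-∘ {zero}  c vs f m = refl
lincomb-∘ {suc k} c vs f m =
  cong (c zero * vs zero (f m) +_) (lincomb-∘ (λ i → c (suc i)) (λ i → vs (suc i)) f m)

lincomb-split : ∀ {a b} (c : Fin (a +ℕ b) → ℚ) (vs : Fin (a +ℕ b) → Vect) n →
  lincomb c vs n ≡ lincomb (λ i → c (i ↑ˡ b)) (λ i → vs (i ↑ˡ b)) n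
                 + lincomb (λ i → c (a ↑ʳ i)) (λ i → vs (a ↑ʳ i)) n
lincomb-split {zero}  c vs n = sym (ℚP.+-identityˡ _)
lincomb-split {suc a} {b} c vs n =
  trans (cong (c zero * vs zero n +_) (lincomb-split {a} {b} (λ i → c (suc i)) (λ i → vs (suc i)) n))
        (sym (ℚP.+-assoc (c zero * vs zero n) _ _))

⧺-independent : ∀ {a b} (I J : List (List ℕ)) (us : Fin a → Vect) (ws : Fin b → Vect) →
  Independent (_∈ I) us → Independent (_∈ J) ws → (∀ i n → n ∈ I → ws i n ≡ 0ℚ) →
  Independent (I ∪ J) (us ⧺ ws)
⧺-independent {a} {b} I J us ws us-indep ws-indep ws≡0-on-I γ vanish i =
  subst (λ j → γ j ≡ 0ℚ) (join-splitAt a b i) (bothHalves (splitAt a i))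
  where
  γˡ = λ i → γ (i ↑ˡ b)
  γʳ = λ i → γ (a ↑ʳ i)
  halves : ∀ n → lincomb γ (us ⧺ ws) n ≡ lincomb γˡ us n + lincomb γʳ ws n
  halves n = trans (lincomb-split {a} {b} γ (us ⧺ ws) n)
    (cong₂ _+_ (lincomb-congᵛ γˡ _ us n (λ i → cong (λ v → v n) (lookup-++ˡ us ws i)))
               (lincomb-congᵛ γʳ _ ws n (λ i → cong (λ v → v n) (lookup-++ʳ us ws i))))
  γˡ≡0 : ∀ i → γˡ i ≡ 0ℚ
  γˡ≡0 = us-indep γˡ λ n n∈I → begin
    lincomb γˡ us n                         ≡⟨ sym (ℚP.+-identityʳ _) ⟩
    lincomb γˡ us n + 0ℚ                    ≡⟨ cong (lincomb γˡ us n +_) (sym (lincomb-zeroᵛ γʳ ws n (λ i → ws≡0-on-I i n n∈I))) ⟩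
    lincomb γˡ us n + lincomb γʳ ws n       ≡⟨ sym (halves n) ⟩
    lincomb γ (us ⧺ ws) n                   ≡⟨ vanish n (inj₁ n∈I) ⟩
    0ℚ                                      ∎
  γʳ≡0 : ∀ i → γʳ i ≡ 0ℚ
  γʳ≡0 = ws-indep γʳ λ n n∈J → begin
    lincomb γʳ ws n                         ≡⟨ sym (ℚP.+-identityˡ _) ⟩
    0ℚ + lincomb γʳ ws n                    ≡⟨ cong (_+ lincomb γʳ ws n) (sym (lincomb-zeroᶜ γˡ us n γˡ≡0)) ⟩
    lincomb γˡ us n + lincomb γʳ ws n       ≡⟨ sym (halves n) ⟩
    lincomb γ (us ⧺ ws) n                   ≡⟨ vanish n (inj₂ n∈J) ⟩
    0ℚ                                      ∎
  bothHalves : ∀ s → γ (join a b s) ≡ 0ℚ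
  bothHalves (inj₁ j) = γˡ≡0 j
  bothHalves (inj₂ j) = γʳ≡0 j

inKer-subspace : ∀ I A → Subspace (InKer I A)
inKer-subspace I A v u β Av≡0 Au≡0 m m∈I = begin
  sumOver (λ n → A m n * (v n + β * u n)) I
    ≡⟨ sumOver-cong _ _ I (λ n _ → solve 4 (λ a b c d → a :* (b :+ c :* d) := a :* b :+ c :* (a :* d)) refl
                                      (A m n) (v n) β (u n)) ⟩
  sumOver (λ n → A m n * v n + β * (A m n * u n)) I
    ≡⟨ sumOver-+ (λ n → A m n * v n) (λ n → β * (A m n * u n)) I ⟩
  sumOver (λ n → A m n * v n) I + sumOver (λ n → β * (A m n * u n)) I
    ≡⟨ cong₂ _+_ (Av≡0 m m∈I) (sym (sumOver-*ˡ β (λ n → A m n * u n) I)) ⟩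
  0ℚ + β * sumOver (λ n → A m n * u n) I
    ≡⟨ cong (λ x → 0ℚ + β * x) (Au≡0 m m∈I) ⟩
  0ℚ + β * 0ℚ
    ≡⟨ trans (ℚP.+-identityˡ _) (ℚP.*-zeroʳ β) ⟩
  0ℚ ∎

inKer-cong : ∀ I A (v v′ : Vect) → (∀ n → v n ≡ v′ n) → InKer I A v → InKer I A v′
inKer-cong I A v v′ v≡v′ Av≡0 m m∈I =
  trans (sumOver-cong _ _ I (λ n _ → cong (A m n *_) (sym (v≡v′ n)))) (Av≡0 m m∈I)

inKer-zero : ∀ I A (v : Vect) → (∀ n → v n ≡ 0ℚ) → InKer I A v
inKer-zero I A v v≡0 m m∈I =
  sumOver-zero _ I (λ n _ → trans (cong (A m n *_) (v≡0 n)) (ℚP.*-zeroʳ (A m n)))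

dimKer⇒hasDim : ∀ I A d → DimKer I A d → HasDim (_∈ I) (InKer I A) d
dimKer⇒hasDim I A d ((vs , vs∈ker , vs-indep) , ker≤d) =
  (vs , vs∈ker , linIndep⇒independent I vs vs-indep) ,
  (λ ws ws∈ker ws-indep → ker≤d ws ws∈ker (independent⇒linIndep I ws ws-indep))

block : ℕ → Vect → Vect
block a v m = v (a ∷ m)

embedBlock : ℕ → Vect → Vect
embedBlock a u []      = 0ℚ
embedBlock a u (x ∷ m) = Δℕ.δ x a (u m)

dropBlock : ℕ → Vect → Vect
dropBlock a v []      = v []
dropBlock a v (x ∷ m) = if ⌊ x ℕP.≟ a ⌋ then 0ℚ else v (x ∷ m)

dropBlock-same : ∀ a v m → dropBlock a v (a ∷ m) ≡ 0ℚ
dropBlock-same a v m with a ℕP.≟ a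
... | yes _  = refl
... | no a≢a = ⊥-elim (a≢a refl)

dropBlock-other : ∀ a v b m → b ≢ a → dropBlock a v (b ∷ m) ≡ v (b ∷ m)
dropBlock-other a v b m b≢a with b ℕP.≟ a
... | yes b≡a = ⊥-elim (b≢a b≡a)
... | no _    = refl

blocks : (ℕ → List (List ℕ)) → List ℕ → List (List ℕ)
blocks F L = concatMap (λ a → map (a ∷_) (F a)) L

blocks⁻ : ∀ F L {n} → n ∈ blocks F L → ∃ λ a → ∃ λ m → n ≡ a ∷ m × a ∈ L × m ∈ F a
blocks⁻ F (a ∷ L) n∈ with ∈-++⁻ (map (a ∷_) (F a)) n∈
... | inj₁ n∈block with ∈-map⁻ (a ∷_) n∈block
...   | m , m∈Fa , refl = a , m , refl , here refl , m∈Fa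
blocks⁻ F (a ∷ L) n∈ | inj₂ n∈rest with blocks⁻ F L n∈rest
...   | b , m , refl , b∈L , m∈Fb = b , m , refl , there b∈L , m∈Fb

blocks⁺ : ∀ F L {a m} → a ∈ L → m ∈ F a → (a ∷ m) ∈ blocks F L
blocks⁺ F (a ∷ L) (here refl) m∈Fa = ∈-++⁺ˡ (∈-map⁺ (a ∷_) m∈Fa)
blocks⁺ F (b ∷ L) (there a∈L) m∈Fa = ∈-++⁺ʳ (map (b ∷_) (F b)) (blocks⁺ F L a∈L m∈Fa)

blocks-unique : ∀ F L → Unique L → (∀ a → Unique (F a)) → Unique (blocks F L)
blocks-unique F []      _              _         = []
blocks-unique F (a ∷ L) (a∉L ∷ L-uniq) F-uniq =
  UniqueP.++⁺ (UniqueP.map⁺ ∷-injective (F-uniq a)) (blocks-unique F L L-uniq F-uniq) disjoint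
  where
  ∷-injective : ∀ {x y : List ℕ} → a ∷ x ≡ a ∷ y → x ≡ y
  ∷-injective refl = refl
  disjoint : ∀ {v} → ¬ (v ∈ map (a ∷_) (F a) × v ∈ blocks F L)
  disjoint (v∈block , v∈rest) with ∈-map⁻ (a ∷_) v∈block | blocks⁻ F L v∈rest
  ... | _ , _ , refl | _ , _ , refl , a∈L , _ = All.lookup a∉L a∈L refl

BlockKer : (ℕ → List (List ℕ)) → (ℕ → Mat) → List ℕ → Vect → Set
BlockKer F B L v = ∀ a → a ∈ L → InKer (F a) (B a) (block a v)

module _ (F : ℕ → List (List ℕ)) (B : ℕ → Mat) where

  blockKer-subspace : ∀ L → Subspace (BlockKer F B L)
  blockKer-subspace L v u β v∈ u∈ a a∈L =
    inKer-subspace (F a) (B a) (block a v) (block a u) β (v∈ a a∈L) (u∈ a a∈L)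

  block-dimAtMost : ∀ a d → DimKer (F a) (B a) d →
    DimAtMost (_∈ map (a ∷_) (F a)) (λ v → InKer (F a) (B a) (block a v)) d
  block-dimAtMost a d (_ , ker≤d) ws ws∈ indep =
    ker≤d (λ i → block a (ws i)) ws∈ (independent⇒linIndep (F a) _ blocks-indep)
    where
    blocks-indep : Independent (_∈ F a) (λ i → block a (ws i))
    blocks-indep γ vanish =
      indep γ λ n n∈ → case ∈-map⁻ (a ∷_) n∈ of λ where
        (m , m∈Fa , refl) → trans (sym (lincomb-∘ γ ws (a ∷_) m)) (vanish m m∈Fa)

  -- Upper bound: dimension is subadditive over the blocks.
  blockKer-dimAtMost : ∀ (c : ℕ → ℕ) L → (∀ a → a ∈ L → DimKer (F a) (B a) (c a)) →
    DimAtMost (_∈ blocks F L) (BlockKer F B L) (sumL (map c L))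
  blockKer-dimAtMost c []      _   = dimAtMost-[] (BlockKer F B [])
  blockKer-dimAtMost c (a ∷ L) dim ws ws∈ indep =
    intersection-bound (suc (c a +ℕ sumL (map c L))) (c a) (sumL (map c L))
      (map (a ∷_) (F a)) (blocks F L) _ (BlockKer F B L)
      (λ v u β v∈ u∈ → inKer-subspace (F a) (B a) (block a v) (block a u) β v∈ u∈) (blockKer-subspace L)
      (block-dimAtMost a (c a) (dim a (here refl))) (blockKer-dimAtMost c L (λ b b∈L → dim b (there b∈L)))
      ℕP.≤-refl ws (λ i → ws∈ i a (here refl)) (λ i b b∈L → ws∈ i b (there b∈L))
      (independent-mono ws (λ n → ∈-++⁻ (map (a ∷_) (F a))) indep)

  -- Lower bound: bases of the block kernels, each embedded into its own block, together
  -- form an independent family of size Σₐ c a.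
  blockKer-basis : ∀ (c : ℕ → ℕ) L → Unique L → (∀ a → a ∈ L → DimKer (F a) (B a) (c a)) →
    ∃ λ (vs : Fin (sumL (map c L)) → Vect) → (∀ i → BlockKer F B L (vs i)) × Independent (_∈ blocks F L) vs
  blockKer-basis c []      _                dim = (λ ()) , (λ ()) , (λ _ _ ())
  blockKer-basis c (a ∷ L) (a∉L ∷ L-uniq) dim =
    U ⧺ W , (λ i → inEitherHalf (splitAt (c a) i)) ,
    independent-mono (U ⧺ W) (λ n → [ ∈-++⁺ˡ , ∈-++⁺ʳ I ]′) (⧺-independent I J U W U-indep W-indep W≡0-on-I)
    where
    I = map (a ∷_) (F a)
    J = blocks F L
    us = proj₁ (proj₁ (dim a (here refl)))
    rest = blockKer-basis c L L-uniq (λ b b∈L → dim b (there b∈L))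
    ws = proj₁ rest
    U : Fin (c a) → Vect
    U i = embedBlock a (us i)
    W : Fin (sumL (map c L)) → Vect
    W i = dropBlock a (ws i)
    other : ∀ {b} → b ∈ L → b ≢ a
    other b∈L b≡a = All.lookup a∉L b∈L (sym b≡a)
    U∈ : ∀ i → BlockKer F B (a ∷ L) (U i)
    U∈ i b (here refl) = inKer-cong (F a) (B a) (us i) _ (λ m → sym (Δℕ.δ-same a (us i m)))
                           (proj₁ (proj₂ (proj₁ (dim a (here refl)))) i)
    U∈ i b (there b∈L) = inKer-zero (F b) (B b) _ (λ m → Δℕ.δ-diff b a (us i m) (other b∈L))
    W∈ : ∀ i → BlockKer F B (a ∷ L) (W i)
    W∈ i b (here refl) = inKer-zero (F a) (B a) _ (dropBlock-same a (ws i))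
    W∈ i b (there b∈L) = inKer-cong (F b) (B b) (block b (ws i)) _
                           (λ m → sym (dropBlock-other a (ws i) b m (other b∈L))) (proj₁ (proj₂ rest) i b b∈L)
    inEitherHalf : ∀ s → BlockKer F B (a ∷ L) ([ U , W ]′ s)
    inEitherHalf (inj₁ j) = U∈ j
    inEitherHalf (inj₂ j) = W∈ j
    U-indep : Independent (_∈ I) U
    U-indep γ vanish = linIndep⇒independent (F a) us (proj₂ (proj₂ (proj₁ (dim a (here refl))))) γ λ m m∈Fa →
      begin
        lincomb γ us m                        ≡⟨ lincomb-congᵛ γ us _ m (λ i → sym (Δℕ.δ-same a (us i m))) ⟩
        lincomb γ (λ i → block a (U i)) m     ≡⟨ lincomb-∘ γ U (a ∷_) m ⟩
        lincomb γ U (a ∷ m)                   ≡⟨ vanish (a ∷ m) (∈-map⁺ (a ∷_) m∈Fa) ⟩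
        0ℚ                                    ∎
    W-indep : Independent (_∈ J) W
    W-indep γ vanish = proj₂ (proj₂ rest) γ λ n n∈J → case blocks⁻ F L n∈J of λ where
      (b , m , refl , b∈L , _) →
        trans (lincomb-congᵛ γ ws W (b ∷ m) (λ i → sym (dropBlock-other a (ws i) b m (other b∈L))))
              (vanish (b ∷ m) n∈J)
    W≡0-on-I : ∀ i n → n ∈ I → W i n ≡ 0ℚ
    W≡0-on-I i n n∈I = case ∈-map⁻ (a ∷_) n∈I of λ where
      (m , _ , refl) → dropBlock-same a (ws i) m

  blockKer-hasDim : ∀ (c : ℕ → ℕ) L → Unique L → (∀ a → a ∈ L → DimKer (F a) (B a) (c a)) →
    HasDim (_∈ blocks F L) (BlockKer F B L) (sumL (map c L))
  blockKer-hasDim c L L-uniq dim = blockKer-basis c L L-uniq dim , blockKer-dimAtMost c L dim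

admissibleᵇ : ℕ → Bool
admissibleᵇ k = oddᵇ k ∧ (3 ≤ᵇ k)

-- The possible first entries of a tuple in S_{N,r} with r ≥ 2: admissible k < N.
-- Summing c (N ∸ k) over them is OConvCoeff c N.
firstEntries : ℕ → List ℕ
firstEntries N = filterᵇ admissibleᵇ (upTo N)

firstEntries-unique : ∀ N → Unique (firstEntries N)
firstEntries-unique N = UniqueP.filter⁺ (T? ∘ admissibleᵇ) (UniqueP.upTo⁺ N)

firstEntries⁻ : ∀ N {a} → a ∈ firstEntries N → a < N × T (admissibleᵇ a)
firstEntries⁻ N a∈ with ∈-filter⁻ (T? ∘ admissibleᵇ) a∈
... | a∈upTo , adm = ∈-upTo⁻ a∈upTo , adm

InS : ℕ → ℕ → List ℕ → Set
InS N r x = length x ≡ r × sumL x ≡ N × T (allᵇ admissibleᵇ x)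

box⁻ : ∀ N r {x} → x ∈ box N r → length x ≡ r
box⁻ N zero    (here refl) = refl
box⁻ N (suc r) x∈ with blocks⁻ (λ _ → box N r) (upTo (suc N)) x∈
... | _ , m , refl , _ , m∈box = cong suc (box⁻ N r m∈box)

box⁺ : ∀ N (x : List ℕ) → All (_≤ N) x → x ∈ box N (length x)
box⁺ N []      []           = here refl
box⁺ N (a ∷ x) (a≤N ∷ x≤N) =
  blocks⁺ (λ _ → box N (length x)) (upTo (suc N)) (∈-upTo⁺ (s≤s a≤N)) (box⁺ N x x≤N)

entries≤sum : ∀ (x : List ℕ) → All (_≤ sumL x) x
entries≤sum []      = []
entries≤sum (a ∷ x) =
  ℕP.m≤m+n a (sumL x) ∷ All.map (λ b≤ → ℕP.≤-trans b≤ (ℕP.m≤n+m (sumL x) a)) (entries≤sum x)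

S⁻ : ∀ N r {x} → x ∈ S N r → InS N r x
S⁻ N r x∈ with ∈-filter⁻ (T? ∘ inSᵇ N) x∈
... | x∈box , inS with Equivalence.to BoolP.T-∧ inS
...   | sum≡N , adm = box⁻ N r x∈box , toWitness sum≡N , adm

S⁺ : ∀ N r {x} → InS N r x → x ∈ S N r
S⁺ N r {x} (refl , refl , adm) =
  ∈-filter⁺ (T? ∘ inSᵇ N) (box⁺ (sumL x) x (entries≤sum x)) (Equivalence.from BoolP.T-∧ (fromWitness refl , adm))

S-unique : ∀ N r → Unique (S N r)
S-unique N r = UniqueP.filter⁺ (T? ∘ inSᵇ N) (box-unique r)
  where
  box-unique : ∀ r → Unique (box N r)
  box-unique zero    = [] ∷ []
  box-unique (suc r) = blocks-unique (λ _ → box N r) (upTo (suc N)) (UniqueP.upTo⁺ (suc N)) (λ _ → box-unique r)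

-- For r ≥ 2, the tuples in S N r are the a ∷ m with a ∈ firstEntries N and m ∈ S (N ∸ a) (r - 1):
-- the remaining entries are admissible, so they sum to at least 3 and a < N.
FirstEntrySplit : ℕ → ℕ → List ℕ → Set
FirstEntrySplit N k x = ∃ λ a → ∃ λ m → x ≡ a ∷ m × a ∈ firstEntries N × m ∈ S (N ∸ a) (suc k)

S-split⁻ : ∀ N k {x} → x ∈ S N (suc (suc k)) → FirstEntrySplit N k x
S-split⁻ N k {x} x∈ = split x (S⁻ N (suc (suc k)) x∈)
  where
  split : ∀ x → InS N (suc (suc k)) x → FirstEntrySplit N k x
  split (a ∷ b ∷ m) (len , sum≡N , adm)
    with Equivalence.to (BoolP.T-∧ {admissibleᵇ a}) adm
  ... | adm-a , adm-rest with Equivalence.to (BoolP.T-∧ {admissibleᵇ b}) adm-rest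
  ...   | adm-b , _ =
    a , b ∷ m , refl , a∈firstEntries , S⁺ (N ∸ a) (suc k) (ℕP.suc-injective len , rest-sum , adm-rest)
    where
    rest-sum : sumL (b ∷ m) ≡ N ∸ a
    rest-sum = trans (sym (ℕP.m+n∸m≡n a (sumL (b ∷ m)))) (cong (_∸ a) sum≡N)
    0<b : 0 < b
    0<b = ℕP.<-≤-trans (s≤s z≤n) (ℕP.≤ᵇ⇒≤ 3 b (proj₂ (Equivalence.to (BoolP.T-∧ {oddᵇ b}) adm-b)))
    a<N : a < N
    a<N = subst (a <_) sum≡N (ℕP.m<m+n a (ℕP.<-≤-trans 0<b (ℕP.m≤m+n b (sumL m))))
    a∈firstEntries : a ∈ firstEntries N
    a∈firstEntries = ∈-filter⁺ (T? ∘ admissibleᵇ) (∈-upTo⁺ a<N) adm-a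

S-split⁺ : ∀ N k {a m} → a ∈ firstEntries N → m ∈ S (N ∸ a) (suc k) → (a ∷ m) ∈ S N (suc (suc k))
S-split⁺ N k {a} {m} a∈ m∈ with firstEntries⁻ N a∈ | S⁻ (N ∸ a) (suc k) m∈
... | a<N , adm-a | len , sum≡N∸a , adm-m =
  S⁺ N (suc (suc k)) (cong suc len , sum≡N , Equivalence.from BoolP.T-∧ (adm-a , adm-m))
  where
  sum≡N : a +ℕ sumL m ≡ N
  sum≡N = trans (cong (a +ℕ_) sum≡N∸a) (ℕP.m+[n∸m]≡n (ℕP.<⇒≤ a<N))

S-blocks : ∀ N k n → n ∈ S N (suc (suc k)) ⇔ n ∈ blocks (λ a → S (N ∸ a) (suc k)) (firstEntries N)
S-blocks N k n = mk⇔ to from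
  where
  to : n ∈ S N (suc (suc k)) → n ∈ blocks (λ a → S (N ∸ a) (suc k)) (firstEntries N)
  to n∈ with S-split⁻ N k n∈
  ... | a , m , refl , a∈ , m∈ = blocks⁺ (λ a → S (N ∸ a) (suc k)) (firstEntries N) a∈ m∈
  from : n ∈ blocks (λ a → S (N ∸ a) (suc k)) (firstEntries N) → n ∈ S N (suc (suc k))
  from n∈ with blocks⁻ (λ a → S (N ∸ a) (suc k)) (firstEntries N) n∈
  ... | a , m , refl , a∈ , m∈ = S-split⁺ N k a∈ m∈

BlockDiagonal : List ℕ → Mat → (ℕ → Mat) → Set
BlockDiagonal L A Blk = ∀ a → a ∈ L → ∀ m b n → A (a ∷ m) (b ∷ n) ≡ Δℕ.δ a b (Blk a m n)

if-==ᴸ-∷ : ∀ a b (m n : List ℕ) (X : ℚ) →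
  (if (a ∷ m) ==ᴸ (b ∷ n) then X else 0ℚ) ≡ Δℕ.δ a b (if m ==ᴸ n then X else 0ℚ)
if-==ᴸ-∷ a b m n X with ListP.≡-dec ℕP._≟_ (a ∷ m) (b ∷ n) | a ℕP.≟ b | ListP.≡-dec ℕP._≟_ m n
... | yes refl  | yes _    | yes _    = refl
... | yes refl  | no a≢a   | _        = ⊥-elim (a≢a refl)
... | yes refl  | yes _    | no m≢m   = ⊥-elim (m≢m refl)
... | no am≢bn  | yes refl | yes refl = ⊥-elim (am≢bn refl)
... | no _      | yes refl | no _     = refl
... | no _      | no _     | _        = refl

idM-blockDiagonal : ∀ L → BlockDiagonal L idM (λ _ → idM)
idM-blockDiagonal L a _ m b n = if-==ᴸ-∷ a b m n 1ℚ

-- For j ≤ r′, E^{(j)}_{r′+1} acts only on the last j coordinates, so it is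
-- block diagonal in the first coordinate with blocks E^{(j)}_{r′}.
Ej-blockDiagonal : ∀ L r′ j → j ≤ r′ → BlockDiagonal L (Ej (suc r′) j) (λ _ → Ej r′ j)
Ej-blockDiagonal L r′ j j≤r′ a _ m b n rewrite ℕP.+-∸-assoc 1 j≤r′ =
  if-==ᴸ-∷ a b (take (r′ ∸ j) m) (take (r′ ∸ j) n) (eCoef (drop (r′ ∸ j) m) (drop (r′ ∸ j) n) ℚ./ 1)

module BlockDiagonalAlgebra (F : ℕ → List (List ℕ)) (L : List ℕ) (L-unique : Unique L)
                            (T : List (List ℕ)) (T↭blocks : T ↭ blocks F L) where

  row-sum : ∀ A Blk → BlockDiagonal L A Blk → ∀ a → a ∈ L → ∀ m (g : Vect) →
    sumOver (λ x → A (a ∷ m) x * g x) T ≡ sumOver (λ y → Blk a m y * g (a ∷ y)) (F a)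
  row-sum A Blk A-bd a a∈L m g = begin
    sumOver (λ x → A (a ∷ m) x * g x) T
      ≡⟨ sumOver-↭ _ T↭blocks ⟩
    sumOver (λ x → A (a ∷ m) x * g x) (blocks F L)
      ≡⟨ sumOver-blocks _ F L ⟩
    sumOver (λ b → sumOver (λ y → A (a ∷ m) (b ∷ y) * g (b ∷ y)) (F b)) L
      ≡⟨ sumOver-cong _ _ L (λ b _ → sumOver-cong _ _ (F b) (λ y _ →
           trans (cong (_* g (b ∷ y)) (A-bd a a∈L m b y)) (Δℕ.δ-*ʳ a b (Blk a m y) (g (b ∷ y))))) ⟩
    sumOver (λ b → sumOver (λ y → Δℕ.δ a b (Blk a m y * g (b ∷ y))) (F b)) L
      ≡⟨ sumOver-cong _ _ L (λ b _ → Δℕ.δ-sumOver a b (λ y → Blk a m y * g (b ∷ y)) (F b)) ⟩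
    sumOver (λ b → Δℕ.δ a b (sumOver (λ y → Blk a m y * g (b ∷ y)) (F b))) L
      ≡⟨ Δℕ.sumOver-δ a (λ b → sumOver (λ y → Blk a m y * g (b ∷ y)) (F b)) L L-unique a∈L ⟩
    sumOver (λ y → Blk a m y * g (a ∷ y)) (F a) ∎

  mulM-blockDiagonal : ∀ A Ablk B Bblk → BlockDiagonal L A Ablk → BlockDiagonal L B Bblk →
    BlockDiagonal L (mulM T A B) (λ a → mulM (F a) (Ablk a) (Bblk a))
  mulM-blockDiagonal A Ablk B Bblk A-bd B-bd a a∈L m b n = begin
    sumOver (λ x → A (a ∷ m) x * B x (b ∷ n)) T
      ≡⟨ row-sum A Ablk A-bd a a∈L m (λ x → B x (b ∷ n)) ⟩
    sumOver (λ y → Ablk a m y * B (a ∷ y) (b ∷ n)) (F a)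
      ≡⟨ sumOver-cong _ _ (F a) (λ y _ →
           trans (cong (Ablk a m y *_) (B-bd a a∈L y b n)) (Δℕ.δ-*ˡ a b (Bblk a y n) (Ablk a m y))) ⟩
    sumOver (λ y → Δℕ.δ a b (Ablk a m y * Bblk a y n)) (F a)
      ≡⟨ Δℕ.δ-sumOver a b (λ y → Ablk a m y * Bblk a y n) (F a) ⟩
    Δℕ.δ a b (mulM (F a) (Ablk a) (Bblk a) m n) ∎

  prodOver-blockDiagonal : ∀ (M M′ : ℕ → Mat) js → (∀ j → j ∈ js → BlockDiagonal L (M j) (λ _ → M′ j)) →
    BlockDiagonal L (prodOver T M js) (λ a → prodOver (F a) M′ js)
  prodOver-blockDiagonal M M′ []       _    = idM-blockDiagonal L
  prodOver-blockDiagonal M M′ (j ∷ js) M-bd =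
    mulM-blockDiagonal (M j) (λ _ → M′ j) (prodOver T M js) (λ a → prodOver (F a) M′ js)
      (M-bd j (here refl)) (prodOver-blockDiagonal M M′ js (λ j′ j′∈ → M-bd j′ (there j′∈)))

  ker-blockDiagonal : ∀ A Blk → BlockDiagonal L A Blk → ∀ v → InKer T A v ⇔ BlockKer F Blk L v
  ker-blockDiagonal A Blk A-bd v = mk⇔ to from
    where
    to : InKer T A v → BlockKer F Blk L v
    to Av≡0 a a∈L m m∈Fa =
      trans (sym (row-sum A Blk A-bd a a∈L m v))
            (Av≡0 (a ∷ m) (↭P.∈-resp-↭ (↭-sym T↭blocks) (blocks⁺ F L a∈L m∈Fa)))
    from : BlockKer F Blk L v → InKer T A v
    from blocks≡0 x x∈T with blocks⁻ F L (↭P.∈-resp-↭ T↭blocks x∈T)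
    ... | a , m , refl , a∈L , m∈Fa = trans (row-sum A Blk A-bd a a∈L m v) (blocks≡0 a a∈L m m∈Fa)

inKer-entrywise : ∀ I A A′ (v : Vect) → (∀ m n → m ∈ I → n ∈ I → A m n ≡ A′ m n) →
  InKer I A v → InKer I A′ v
inKer-entrywise I A A′ v A≡A′ Av≡0 m m∈I =
  trans (sumOver-cong _ _ I (λ n n∈I → cong (_* v n) (sym (A≡A′ m n m∈I n∈I)))) (Av≡0 m m∈I)

hasDim-transport : ∀ {C C′ P P′ d} → (∀ n → C n ⇔ C′ n) → (∀ v → P v ⇔ P′ v) →
  HasDim C P d → HasDim C′ P′ d
hasDim-transport C⇔C′ P⇔P′ ((vs , vs∈P , vs-indep) , P≤d) =
  (vs , (λ i → Equivalence.to (P⇔P′ (vs i)) (vs∈P i)) ,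
        independent-mono vs (λ n → Equivalence.to (C⇔C′ n)) vs-indep) ,
  (λ ws ws∈P′ ws-indep → P≤d ws (λ i → Equivalence.from (P⇔P′ (ws i)) (ws∈P′ i))
                              (independent-mono ws (λ n → Equivalence.from (C⇔C′ n)) ws-indep))

midRange-snoc : ∀ k → midRange (3 +ℕ k) ≡ midRange (2 +ℕ k) ++ (2 +ℕ k ∷ [])
midRange-snoc k = trans (cong (map (2 +ℕ_)) (sym (ListP.applyUpTo-∷ʳ (λ i → i) k)))
                        (ListP.map-++ (2 +ℕ_) (upTo k) (k ∷ []))

midRange-≤ : ∀ k {j} → j ∈ midRange (3 +ℕ k) → j ≤ 2 +ℕ k
midRange-≤ k j∈ with ∈-map⁻ (2 +ℕ_) j∈
... | i , i∈ , refl = s≤s (s≤s (ℕP.≤-pred (∈-upTo⁻ i∈)))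

-- E^{(2)}_{N,r′} ⋯ E^{(r′)}_{N,r′} = C_{N,r′} for r′ ≥ 2: the last factor E^{(r′)} is E_{N,r′}.
prodOver-extended : ∀ N k m n → m ∈ S N (2 +ℕ k) → n ∈ S N (2 +ℕ k) →
  prodOver (S N (2 +ℕ k)) (Ej (2 +ℕ k)) (midRange (3 +ℕ k)) m n ≡ C N (2 +ℕ k) m n
prodOver-extended N k m n m∈S n∈S = begin
  prodOver I M (midRange (3 +ℕ k)) m n
    ≡⟨ cong (λ js → prodOver I M js m n) (midRange-snoc k) ⟩
  prodOver I M (midRange r′ ++ (r′ ∷ [])) m n
    ≡⟨ cong (λ P → P m n) (ListP.foldr-++ (λ j P → mulM I (M j) P) idM (midRange r′) (r′ ∷ [])) ⟩
  foldr (λ j P → mulM I (M j) P) (mulM I (E r′) idM) (midRange r′) m n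
    ≡⟨ prodOver-snoc I M (E r′) (midRange r′) m n (S-unique N r′) m∈S n∈S ⟩
  C N r′ m n ∎
  where
  r′ = 2 +ℕ k
  I = S N r′
  M = Ej r′

S↭blocks : ∀ N k → S N (suc (suc k)) ↭ blocks (λ a → S (N ∸ a) (suc k)) (firstEntries N)
S↭blocks N k = ∼bag⇒↭ (unique∧set⇒bag (S-unique N (suc (suc k)))
  (blocks-unique _ (firstEntries N) (firstEntries-unique N) (λ a → S-unique (N ∸ a) (suc k)))
  (λ {n} → S-blocks N k n))

ker-prodE⇔blockKer : ∀ N k v →
  InKer (S N (3 +ℕ k)) (prodE N (3 +ℕ k)) v ⇔
  BlockKer (λ a → S (N ∸ a) (2 +ℕ k)) (λ a → C (N ∸ a) (2 +ℕ k)) (firstEntries N) v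
ker-prodE⇔blockKer N k v = mk⇔
  (λ v∈ker a a∈L → blockC (Equivalence.to ker⇔ v∈ker a a∈L))
  (λ v∈blocks → Equivalence.from ker⇔ (λ a a∈L → blockC⁻¹ (v∈blocks a a∈L)))
  where
  F = λ a → S (N ∸ a) (2 +ℕ k)
  L = firstEntries N
  open BlockDiagonalAlgebra F L (firstEntries-unique N) (S N (3 +ℕ k)) (S↭blocks N (suc k))
  blockP : ℕ → Mat
  blockP a = prodOver (F a) (Ej (2 +ℕ k)) (midRange (3 +ℕ k))
  ker⇔ : InKer (S N (3 +ℕ k)) (prodE N (3 +ℕ k)) v ⇔ BlockKer F blockP L v
  ker⇔ = ker-blockDiagonal (prodE N (3 +ℕ k)) blockP
    (prodOver-blockDiagonal (Ej (3 +ℕ k)) (Ej (2 +ℕ k)) (midRange (3 +ℕ k))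
      (λ j j∈ → Ej-blockDiagonal L (2 +ℕ k) j (midRange-≤ k j∈))) v
  blockC : ∀ {a} → InKer (F a) (blockP a) (block a v) → InKer (F a) (C (N ∸ a) (2 +ℕ k)) (block a v)
  blockC {a} = inKer-entrywise (F a) _ _ (block a v) (λ m n m∈ n∈ → prodOver-extended (N ∸ a) k m n m∈ n∈)
  blockC⁻¹ : ∀ {a} → InKer (F a) (C (N ∸ a) (2 +ℕ k)) (block a v) → InKer (F a) (blockP a) (block a v)
  blockC⁻¹ {a} = inKer-entrywise (F a) _ _ (block a v) (λ m n m∈ n∈ → sym (prodOver-extended (N ∸ a) k m n m∈ n∈))

corollary4p3 : (r : ℕ) → 3 ≤ r →
    (d c : ℕ → ℕ) →
    (∀ N → 0 < N → DimKer (S N r) (prodE N r) (d N)) →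
    (∀ N → 0 < N → DimKer (S N (r ∸ 1)) (C N (r ∸ 1)) (c N)) →
    ∀ N → 0 < N → d N ≡ OConvCoeff c N
corollary4p3 (suc (suc (suc k))) (s≤s (s≤s (s≤s _))) d c dimProdE dimC N 0<N =
  hasDim-unique (S N r) (InKer (S N r) (prodE N r)) (inKer-subspace (S N r) (prodE N r))
    (dimKer⇒hasDim (S N r) (prodE N r) (d N) (dimProdE N 0<N))
    (hasDim-transport (λ n → ⇔-sym (S-blocks N (suc k) n)) (λ v → ⇔-sym (ker-prodE⇔blockKer N k v))
      (blockKer-hasDim F (λ a → C (N ∸ a) r′) (λ a → c (N ∸ a)) (firstEntries N) (firstEntries-unique N)
        (λ a a∈ → dimC (N ∸ a) (ℕP.m<n⇒0<n∸m (proj₁ (firstEntries⁻ N a∈))))))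
  where
  r′ = suc (suc k)
  r = suc r′
  F = λ a → S (N ∸ a) r′
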